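{- Let $\Lambda$ and $\Lambda'$ be any permutation local limits. Then there exists a sequence of permutations $(\varphi_j)_{j\in\mathbb{N}}$ that converges locally to $\Lambda$ such that the inverse sequence $(\varphi_j^{ -1})_{j\in\mathbb{N}}$ converges locally to $\Lambda'$.
   Context: A permutation of length $n$ is a bijection $\sigma:[n]\to[n]$; $\sigma^{ -1}$ is its inverse; $S$ is the set of all permutations. For $\pi$ of length $k$ and $\sigma$ of length $n\ge k$, let $\rho_k(\pi,\sigma)$ be the number of $i\in\{1,\dots,n-k+1\}$ such that $\sigma(i)\dots\sigma(i+k-1)$ is order-isomorphic to $\pi$, divided by $n-k+1$. A sequence $(\sigma_j)$ with $|\sigma_j|\to\infty$ converges locally to $\Lambda\in[0,1]^S$ if $\rho_{|\pi|}(\pi,\sigma_j)\to\Lambda_\pi$ for every $\pi\in S$. A permutation local limit is any $\Lambda$ to which some sequence of permutations converges locally. -}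

module Defs where

open import Data.Nat as ℕ using (ℕ; zero; suc; _+_; _∸_; _<ᵇ_; _<?_)
open import Data.Fin using (Fin; toℕ; fromℕ<)
open import Data.Fin.Permutation using (Permutation′; _⟨$⟩ʳ_; flip)
open import Data.Bool using (Bool; true; false; _∧_; if_then_else_)
open import Data.Bool.Properties using () renaming (_≟_ to _≟ᵇ_)
open import Data.List using (List; upTo; allFin; filterᵇ; length; map; foldr)
open import Data.Integer using (+_)
open import Data.Rational as ℚ using (ℚ; _≤_; _<_; _-_; ∣_∣; 0ℚ)
open import Data.Product using (Σ; ∃; _×_; _,_)
open import Relation.Nullary using (yes; no; does)

record Perm : Set where
  constructor perm
  field
    len : ℕ
    σ   : Permutation′ len
open Perm public

inv : Perm → Perm
inv (perm n s) = perm n (flip s)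

-- σ as a function on ℕ (positions 0..n-1; value 0 outside, never used)
valℕ : Perm → ℕ → ℕ
valℕ (perm n s) j with j <? n
... | yes p = toℕ (s ⟨$⟩ʳ fromℕ< p)
... | no _  = 0

allᵇ : {A : Set} → (A → Bool) → List A → Bool
allᵇ p xs = foldr (λ x r → p x ∧ r) true xs

_==ᵇ_ : Bool → Bool → Bool
a ==ᵇ b = does (a ≟ᵇ b)

-- the window σ(i+1) … σ(i+k) (0-indexed start i) is order-isomorphic to π, k = |π|
occursAt : Perm → Perm → ℕ → Bool
occursAt π σ' i =
  allᵇ (λ a → allᵇ (λ b →
        (valℕ π (toℕ a) <ᵇ valℕ π (toℕ b)) ==ᵇ
        (valℕ σ' (i + toℕ a) <ᵇ valℕ σ' (i + toℕ b)))
      (allFin (len π))) (allFin (len π))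

occCount : Perm → Perm → ℕ
occCount π σ' = length (filterᵇ (occursAt π σ') (upTo (suc (len σ' ∸ len π))))

-- ρ_{|π|}(π,σ) = occCount / (n-k+1); (when n < k this is a junk value,
-- irrelevant for local convergence since |σ_j| → ∞)
ρ : Perm → Perm → ℚ
ρ π σ' = (+ occCount π σ') ℚ./ suc (len σ' ∸ len π)

-- Real numbers à la Bishop: regular Cauchy sequences of rationals
record ℝ : Set where
  field
    seq : ℕ → ℚ
    reg : ∀ m n → ∣ seq m - seq n ∣ ≤ ((+ 1) ℚ./ suc m) ℚ.+ ((+ 1) ℚ./ suc n)
open ℝ public

WithinR : ℚ → ℚ → ℝ → Set
WithinR ε q x = ∀ n → ∣ q - seq x n ∣ ≤ ε ℚ.+ ((+ 1) ℚ./ suc n)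

ConvergesTo : (ℕ → ℚ) → ℝ → Set
ConvergesTo a x = ∀ (ε : ℚ) → 0ℚ < ε → ∃ λ N → ∀ j → N ℕ.≤ j → WithinR ε (a j) x

LengthsDiverge : (ℕ → Perm) → Set
LengthsDiverge s = ∀ M → ∃ λ N → ∀ j → N ℕ.≤ j → M ℕ.≤ len (s j)

ConvergesLocally : (ℕ → Perm) → (Perm → ℝ) → Set
ConvergesLocally s Λ = LengthsDiverge s × (∀ π → ConvergesTo (λ j → ρ π (s j)) (Λ π))

IsLocalLimit : (Perm → ℝ) → Set
IsLocalLimit Λ = ∃ λ (s : ℕ → Perm) → ConvergesLocally s Λ

module Submission where

-- Take s_j → Λ and t_j → Λ′ and put φ_j = s_j ⊙ t_j, the block product of length
-- |s_j|·|t_j| with (s ⊙ t)(n·b + a) = m·s(a) + t⁻¹(b) (n = |s|, m = |t|).  Then φ_j is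
-- |t_j| consecutive blocks each order-isomorphic to s_j, and φ_j⁻¹ is |s_j| consecutive
-- blocks each order-isomorphic to t_j.  The key estimate (ρ-repeats) is that repeating σ in
-- M ≥ 1 blocks changes the density of a pattern π by at most |π|/(|σ| − |π| + 1): windows
-- inside a block behave as in σ, and only the |π| − 1 windows straddling each block
-- boundary are uncontrolled.  Since that error tends to 0 as |σ| → ∞, repeated blocks have
-- the same local limit (repeats-converge), and the theorem follows.

open import Defs
open import Data.Nat using (ℕ)
open import Data.Product using (∃; _×_)

open import Data.Nat as ℕ using (zero; suc; _+_; _*_; _∸_; _≤_; _<_; z≤n; s≤s; _⊔_; _<ᵇ_; _<?_)
import Data.Nat.Properties as ℕP
open import Data.Nat.Tactic.RingSolver using (solve-∀)
open import Data.Integer as ℤ using (+_; _⊖_)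
import Data.Integer.Properties as ℤP
open import Data.Rational as ℚ using (ℚ; mkℚ; toℚᵘ; 0ℚ; ½; ∣_∣; *<*)
import Data.Rational.Properties as ℚP
open import Data.Rational.Unnormalised as ℚᵘ using (mkℚᵘ; *≤*)
import Data.Rational.Unnormalised.Properties as ℚᵘP
open import Data.Rational.Solver using (module +-*-Solver)
open import Data.Bool using (Bool; true; false; _∧_)
open import Data.List using (List; []; _∷_; upTo; applyUpTo; filterᵇ; length; allFin)
open import Data.Fin using (Fin; toℕ; fromℕ<; combine; remQuot; cast)
open import Data.Fin.Properties using (toℕ<n; toℕ-fromℕ<; fromℕ<-toℕ; toℕ-cast; cast-involutive; toℕ-combine; remQuot-combine; *↔×)
open import Data.Fin.Permutation using (Permutation′; _⟨$⟩ʳ_; _⟨$⟩ˡ_; flip; cast-id)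
open import Data.Product using (_,_; proj₁; proj₂)
open import Data.Product.Algebra using (×-comm)
open import Data.Product.Function.NonDependent.Propositional using (_×-↔_)
open import Data.Sum using (inj₁; inj₂)
open import Data.Empty using (⊥-elim)
open import Function using (_∘_; id)
open import Function.Construct.Composition using (_↔-∘_)
open import Function.Construct.Symmetry using (↔-sym)
open import Relation.Nullary using (yes; no)
open import Relation.Nullary.Reflects using (fromEquivalence; det)
open import Relation.Binary.PropositionalEquality

Eventually : (ℕ → Set) → Set
Eventually P = ∃ λ N → ∀ j → N ≤ j → P j

eventually-both : ∀ {P Q : ℕ → Set} → Eventually P → Eventually Q → Eventually (λ j → P j × Q j)
eventually-both (N₁ , p) (N₂ , q) =
  N₁ ⊔ N₂ , λ j N≤j → p j (ℕP.m⊔n≤o⇒m≤o N₁ N₂ N≤j) , q j (ℕP.m⊔n≤o⇒n≤o N₁ N₂ N≤j)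

eventually-map : ∀ {P Q : ℕ → Set} → (∀ j → P j → Q j) → Eventually P → Eventually Q
eventually-map f (N , p) = N , λ j N≤j → f j (p j N≤j)

Close : (ℕ → ℚ) → (ℕ → ℚ) → Set
Close b a = ∀ ε → 0ℚ ℚ.< ε → Eventually (λ j → ∣ b j ℚ.- a j ∣ ℚ.≤ ε)

converges-if-close : ∀ a b x → ConvergesTo a x → Close b a → ConvergesTo b x
converges-if-close a b x a→x b≈a ε ε>0 =
  eventually-map within (eventually-both (a→x δ δ>0) (b≈a δ δ>0))
  where
  δ : ℚ
  δ = ε ℚ.* ½
  δ>0 : 0ℚ ℚ.< δ
  δ>0 = ℚP.*-monoˡ-<-pos ½ ε>0
  halves : δ ℚ.+ δ ≡ ε
  halves = trans (sym (ℚP.*-distribˡ-+ ε ½ ½)) (ℚP.*-identityʳ ε)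
  split : ∀ p q r → p ℚ.- r ≡ (p ℚ.- q) ℚ.+ (q ℚ.- r)
  split = solve 3 (λ p q r → p :- r := (p :- q) :+ (q :- r)) refl
    where open +-*-Solver
  within : ∀ j → WithinR δ (a j) x × ∣ b j ℚ.- a j ∣ ℚ.≤ δ → WithinR ε (b j) x
  within j (a≈x , b≈a) n = begin
      ∣ b j ℚ.- seq x n ∣                      ≡⟨ cong ∣_∣ (split (b j) (a j) (seq x n)) ⟩
      ∣ (b j ℚ.- a j) ℚ.+ (a j ℚ.- seq x n) ∣  ≤⟨ ℚP.∣p+q∣≤∣p∣+∣q∣ (b j ℚ.- a j) (a j ℚ.- seq x n) ⟩
      ∣ b j ℚ.- a j ∣ ℚ.+ ∣ a j ℚ.- seq x n ∣  ≤⟨ ℚP.+-mono-≤ b≈a (a≈x n) ⟩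
      δ ℚ.+ (δ ℚ.+ t)                          ≡⟨ ℚP.+-assoc δ δ t ⟨
      (δ ℚ.+ δ) ℚ.+ t                          ≡⟨ cong (ℚ._+ t) halves ⟩
      ε ℚ.+ t ∎
    where
    open ℚP.≤-Reasoning
    t = (+ 1) ℚ./ suc n

window-error-vanishes : ∀ k δ → 0ℚ ℚ.< δ → ∃ λ T → ∀ n → T ≤ n → (+ k) ℚ./ suc (n ∸ k) ℚ.≤ δ
window-error-vanishes k (mkℚ (+ zero) q _) (*<* (ℤ.+<+ ()))
window-error-vanishes k (mkℚ ℤ.-[1+ p ] q _) (*<* ())
window-error-vanishes k (mkℚ (+ suc p) q _) _ = k + k * suc q , λ n T≤n →
  ℚP.toℚᵘ-cancel-≤ (ℚᵘP.≤-respˡ-≃ (ℚᵘP.≃-sym (ℚP.toℚᵘ-fromℚᵘ (mkℚᵘ (+ k) (n ∸ k))))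
    (*≤* (cross n T≤n)))
  where
  cross : ∀ n → k + k * suc q ≤ n → + k ℤ.* + suc q ℤ.≤ + suc p ℤ.* + suc (n ∸ k)
  cross n T≤n rewrite sym (ℤP.pos-* k (suc q)) | sym (ℤP.pos-* (suc p) (suc (n ∸ k))) =
    ℤ.+≤+ (ℕP.≤-trans (ℕP.m≤n⇒m≤1+n kq≤n-k) (ℕP.m≤n*m (suc (n ∸ k)) (suc p)))
    where
    kq≤n-k : k * suc q ≤ n ∸ k
    kq≤n-k = subst (_≤ n ∸ k) (ℕP.m+n∸m≡n k (k * suc q)) (ℕP.∸-monoˡ-≤ k T≤n)

close-if-window-bounded : ∀ (b a : ℕ → ℚ) k (n : ℕ → ℕ) → (∀ M → Eventually (λ j → M ≤ n j)) →
  Eventually (λ j → ∣ b j ℚ.- a j ∣ ℚ.≤ (+ k) ℚ./ suc (n j ∸ k)) → Close b a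
close-if-window-bounded b a k n n→∞ bounded ε ε>0 =
  eventually-map (λ j (b≈a , T≤n) → ℚP.≤-trans b≈a (small (n j) T≤n))
    (eventually-both bounded (n→∞ T))
  where
  T : ℕ
  T = proj₁ (window-error-vanishes k ε ε>0)
  small : ∀ n → T ≤ n → (+ k) ℚ./ suc (n ∸ k) ℚ.≤ ε
  small = proj₂ (window-error-vanishes k ε ε>0)

bit : Bool → ℕ
bit true  = 1
bit false = 0

count : (ℕ → Bool) → ℕ → ℕ
count f zero    = 0
count f (suc n) = bit (f 0) + count (f ∘ suc) n

length-filter-applyUpTo : ∀ f (g : ℕ → ℕ) n → length (filterᵇ f (applyUpTo g n)) ≡ count (f ∘ g) n
length-filter-applyUpTo f g zero = refl
length-filter-applyUpTo f g (suc n) with f (g 0)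
... | true  = cong suc (length-filter-applyUpTo f (g ∘ suc) n)
... | false = length-filter-applyUpTo f (g ∘ suc) n

length-filter-upTo : ∀ f n → length (filterᵇ f (upTo n)) ≡ count f n
length-filter-upTo f = length-filter-applyUpTo f id

count-+ : ∀ f a b → count f (a + b) ≡ count f a + count (λ i → f (a + i)) b
count-+ f zero    b = refl
count-+ f (suc a) b = trans (cong (ℕ._+_ (bit (f 0))) (count-+ (f ∘ suc) a b))
                            (sym (ℕP.+-assoc (bit (f 0)) _ _))

count-cong : ∀ f g n → (∀ i → i < n → f i ≡ g i) → count f n ≡ count g n
count-cong f g zero    _ = refl
count-cong f g (suc n) f≗g =
  cong₂ _+_ (cong bit (f≗g 0 (s≤s z≤n))) (count-cong (f ∘ suc) (g ∘ suc) n (λ i i<n → f≗g (suc i) (s≤s i<n)))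

bit≤1 : ∀ b → bit b ≤ 1
bit≤1 true  = ℕP.≤-refl
bit≤1 false = z≤n

count≤ : ∀ f n → count f n ≤ n
count≤ f zero    = z≤n
count≤ f (suc n) = ℕP.+-mono-≤ (bit≤1 (f 0)) (count≤ (f ∘ suc) n)

count-all : ∀ f n → (∀ i → f i ≡ true) → count f n ≡ n
count-all f zero    _ = refl
count-all f (suc n) all rewrite all 0 = cong suc (count-all (f ∘ suc) n (all ∘ suc))

-- Block counting: if c agrees with e on the first D positions of each of the blocks
-- 0..M of length D + g, then on [0, (M+1)D + Mg) (the blocks without the last gap)
-- c counts M+1 copies of #e on [0, D), plus at most g for each of the M gaps.
repeated-count : ∀ (c e : ℕ → Bool) D g M →
  (∀ b x → b ≤ M → x < D → c ((D + g) * b + x) ≡ e x) →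
  ∃ λ r → r ≤ M * g × count c (suc M * D + M * g) ≡ suc M * count e D + r
repeated-count c e D g zero agree = 0 , z≤n , (begin
    count c (1 * D + 0 * g) ≡⟨ cong (count c) (one-block D g) ⟩
    count c D               ≡⟨ count-cong c e D (λ x x<D → trans (cong c (first-block D g x)) (agree 0 x z≤n x<D)) ⟩
    count e D               ≡⟨ one-copy (count e D) ⟩
    1 * count e D + 0 ∎)
  where
  open ≡-Reasoning
  one-block : ∀ D g → 1 * D + 0 * g ≡ D
  one-block = solve-∀
  first-block : ∀ D g x → x ≡ (D + g) * 0 + x
  first-block = solve-∀
  one-copy : ∀ O → O ≡ 1 * O + 0
  one-copy = solve-∀
repeated-count c e D g (suc M) agree with repeated-count c e D g M (λ b x b≤M → agree b x (ℕP.m≤n⇒m≤1+n b≤M))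
... | r , r≤Mg , previous = r + gap , r+gap≤ , (begin
    count c (suc (suc M) * D + suc M * g)         ≡⟨ cong (count c) (next-block D g M) ⟩
    count c (X + (g + D))                         ≡⟨ count-+ c X (g + D) ⟩
    count c X + count (λ i → c (X + i)) (g + D)   ≡⟨ cong (ℕ._+_ (count c X)) (count-+ (λ i → c (X + i)) g D) ⟩
    count c X + (gap + count (λ i → c (X + (g + i))) D)
      ≡⟨ cong₂ (λ u v → u + (gap + v)) previous (count-cong _ e D last-block) ⟩
    (suc M * O + r) + (gap + O)                   ≡⟨ regroup O r gap M ⟩
    suc (suc M) * O + (r + gap) ∎)
  where
  open ≡-Reasoning
  X = suc M * D + M * g
  O = count e D
  gap = count (λ i → c (X + i)) g
  r+gap≤ : r + gap ≤ suc M * g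
  r+gap≤ = subst (r + gap ≤_) (ℕP.+-comm (M * g) g) (ℕP.+-mono-≤ r≤Mg (count≤ _ g))
  next-block : ∀ D g M → suc (suc M) * D + suc M * g ≡ (suc M * D + M * g) + (g + D)
  next-block = solve-∀
  block-start : ∀ D g M x → (suc M * D + M * g) + (g + x) ≡ (D + g) * suc M + x
  block-start = solve-∀
  last-block : ∀ x → x < D → c (X + (g + x)) ≡ e x
  last-block x x<D = trans (cong c (block-start D g M x)) (agree (suc M) x ℕP.≤-refl x<D)
  regroup : ∀ O r gap M → (suc M * O + r) + (gap + O) ≡ suc (suc M) * O + (r + gap)
  regroup = solve-∀

-- With A = (M+1)·O + r successes out of W = (M+1)·D + M·g, where O ≤ D and r ≤ M·g,
-- the density A/W is within (g+1)/D of O/D (stated cross-multiplied).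
repeated-density-bounds : ∀ O D g M r → O ≤ D → r ≤ M * g →
  let A = suc M * O + r; W = suc M * D + M * g; k = suc g in
  A * D ≤ (O + k) * W × O * W ≤ A * D + k * W
repeated-density-bounds O D g M r O≤D r≤Mg = upper , lower
  where
  open ℕP.≤-Reasoning
  A = suc M * O + r
  W = suc M * D + M * g
  k = suc g
  Mg≤ : M * g ≤ suc M * k
  Mg≤ = ℕP.*-mono-≤ (ℕP.n≤1+n M) (ℕP.n≤1+n g)
  blocks≤W : suc M * D ≤ W
  blocks≤W = ℕP.m≤m+n (suc M * D) (M * g)
  factor : ∀ M O k D → (suc M * O + suc M * k) * D ≡ (O + k) * (suc M * D)
  factor = solve-∀
  expand : ∀ M O D g → O * (suc M * D + M * g) ≡ suc M * O * D + O * (M * g)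
  expand = solve-∀
  swap : ∀ M D k → D * (suc M * k) ≡ k * (suc M * D)
  swap = solve-∀
  upper : A * D ≤ (O + k) * W
  upper = begin
    A * D                          ≤⟨ ℕP.*-monoˡ-≤ D (ℕP.+-monoʳ-≤ (suc M * O) (ℕP.≤-trans r≤Mg Mg≤)) ⟩
    (suc M * O + suc M * k) * D    ≡⟨ factor M O k D ⟩
    (O + k) * (suc M * D)          ≤⟨ ℕP.*-monoʳ-≤ (O + k) blocks≤W ⟩
    (O + k) * W ∎
  lower : O * W ≤ A * D + k * W
  lower = begin
    O * W                          ≡⟨ expand M O D g ⟩
    suc M * O * D + O * (M * g)    ≤⟨ ℕP.+-mono-≤ (ℕP.*-monoˡ-≤ D (ℕP.m≤m+n (suc M * O) r)) (ℕP.*-mono-≤ O≤D Mg≤) ⟩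
    A * D + D * (suc M * k)        ≡⟨ cong (ℕ._+_ (A * D)) (swap M D k) ⟩
    A * D + k * (suc M * D)        ≤⟨ ℕP.+-monoʳ-≤ (A * D) (ℕP.*-monoʳ-≤ k blocks≤W) ⟩
    A * D + k * W ∎

∣⊖∣≤ : ∀ x y b → x ≤ y + b → y ≤ x + b → ℤ.∣ x ⊖ y ∣ ≤ b
∣⊖∣≤ x y b x≤y+b y≤x+b with ℕP.≤-total x y
... | inj₁ x≤y rewrite ℤP.∣⊖∣-≤ x≤y = ℕP.m≤n+o⇒m∸n≤o y x y≤x+b
... | inj₂ y≤x rewrite ℤP.∣m⊖n∣≡∣n⊖m∣ x y | ℤP.∣⊖∣-≤ y≤x = ℕP.m≤n+o⇒m∸n≤o x y x≤y+b

fraction-distanceᵘ : ∀ A O k w d → let W = suc w; D = suc d in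
  A * D ≤ (O + k) * W → O * W ≤ A * D + k * W →
  ℚᵘ.∣ mkℚᵘ (+ A) w ℚᵘ.- mkℚᵘ (+ O) d ∣ ℚᵘ.≤ mkℚᵘ (+ k) d
fraction-distanceᵘ A O k w d upper lower = *≤* (begin
    + ℤ.∣ + A ℤ.* + D ℤ.+ ℤ.- + O ℤ.* + W ∣ ℤ.* + D ≡⟨ cong (λ z → + ℤ.∣ z ∣ ℤ.* + D) numerator ⟩
    + ℤ.∣ (A * D) ⊖ (O * W) ∣ ℤ.* + D           ≡⟨ ℤP.pos-* ℤ.∣ (A * D) ⊖ (O * W) ∣ D ⟨
    + (ℤ.∣ (A * D) ⊖ (O * W) ∣ * D)              ≤⟨ ℤ.+≤+ (ℕP.*-monoˡ-≤ D distance) ⟩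
    + (k * W * D)                                 ≡⟨ cong +_ (ℕP.*-assoc k W D) ⟩
    + (k * (W * D))                               ≡⟨ ℤP.pos-* k (W * D) ⟩
    + k ℤ.* + (W * D) ∎)
  where
  open ℤP.≤-Reasoning
  W = suc w
  D = suc d
  numerator : + A ℤ.* + D ℤ.+ ℤ.- + O ℤ.* + W ≡ (A * D) ⊖ (O * W)
  numerator = begin-equality
    + A ℤ.* + D ℤ.+ ℤ.- + O ℤ.* + W ≡⟨ cong₂ ℤ._+_ (ℤP.pos-* A D) (ℤP.neg-distribˡ-* (+ O) (+ W)) ⟨
    + (A * D) ℤ.+ ℤ.- (+ O ℤ.* + W) ≡⟨ cong (λ z → + (A * D) ℤ.+ ℤ.- z) (ℤP.pos-* O W) ⟨
    + (A * D) ℤ.+ ℤ.- + (O * W)      ≡⟨ ℤP.m-n≡m⊖n (A * D) (O * W) ⟩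
    (A * D) ⊖ (O * W) ∎
  distance : ℤ.∣ (A * D) ⊖ (O * W) ∣ ≤ k * W
  distance = ∣⊖∣≤ (A * D) (O * W) (k * W)
    (subst (A * D ≤_) (ℕP.*-distribʳ-+ W O k) upper) lower

fraction-distance : ∀ A O k w d → let W = suc w; D = suc d in
  A * D ≤ (O + k) * W → O * W ≤ A * D + k * W →
  ∣ (+ A) ℚ./ W ℚ.- (+ O) ℚ./ D ∣ ℚ.≤ (+ k) ℚ./ D
fraction-distance A O k w d upper lower = ℚP.toℚᵘ-cancel-≤ (begin
    toℚᵘ ∣ x ℚ.- y ∣                   ≃⟨ ℚP.toℚᵘ-homo-∣-∣ (x ℚ.- y) ⟩
    ℚᵘ.∣ toℚᵘ (x ℚ.- y) ∣              ≃⟨ ℚᵘP.∣-∣-cong (ℚP.toℚᵘ-homo-+ x (ℚ.- y)) ⟩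
    ℚᵘ.∣ toℚᵘ x ℚᵘ.+ toℚᵘ (ℚ.- y) ∣    ≃⟨ ℚᵘP.∣-∣-cong (ℚᵘP.+-cong (unnormalise (+ A) w)
                                           (ℚᵘP.≃-trans (ℚP.toℚᵘ-homo‿- y) (ℚᵘP.-‿cong (unnormalise (+ O) d)))) ⟩
    ℚᵘ.∣ mkℚᵘ (+ A) w ℚᵘ.- mkℚᵘ (+ O) d ∣ ≤⟨ fraction-distanceᵘ A O k w d upper lower ⟩
    mkℚᵘ (+ k) d                        ≃⟨ unnormalise (+ k) d ⟨
    toℚᵘ ((+ k) ℚ./ suc d) ∎)
  where
  open ℚᵘP.≤-Reasoning
  x = (+ A) ℚ./ suc w
  y = (+ O) ℚ./ suc d
  unnormalise : ∀ a w → toℚᵘ (a ℚ./ suc w) ℚᵘ.≃ mkℚᵘ a w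
  unnormalise a w = ℚP.toℚᵘ-fromℚᵘ (mkℚᵘ a w)

record Repeats (σ ψ : Perm) (M : ℕ) : Set where
  field
    length-eq  : len ψ ≡ M * len σ
    same-order : ∀ b y z → b < M → y < len σ → z < len σ →
      (valℕ ψ (len σ * b + y) <ᵇ valℕ ψ (len σ * b + z)) ≡ (valℕ σ y <ᵇ valℕ σ z)
open Repeats

allᵇ-cong : ∀ {A : Set} {p q : A → Bool} (xs : List A) → (∀ a → p a ≡ q a) → allᵇ p xs ≡ allᵇ q xs
allᵇ-cong []       p≗q = refl
allᵇ-cong (x ∷ xs) p≗q = cong₂ _∧_ (p≗q x) (allᵇ-cong xs p≗q)

window-in-block : ∀ π σ ψ M b x → Repeats σ ψ M → b < M → x + len π ≤ len σ →
  occursAt π ψ (len σ * b + x) ≡ occursAt π σ x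
window-in-block π σ ψ M b x reps b<M fits =
  allᵇ-cong (allFin (len π)) λ i → allᵇ-cong (allFin (len π)) λ j →
    cong ((valℕ π (toℕ i) <ᵇ valℕ π (toℕ j)) ==ᵇ_)
      (trans (cong₂ _<ᵇ_ (cong (valℕ ψ) (ℕP.+-assoc (len σ * b) x (toℕ i)))
                         (cong (valℕ ψ) (ℕP.+-assoc (len σ * b) x (toℕ j))))
             (same-order reps b (x + toℕ i) (x + toℕ j) b<M (inside i) (inside j)))
  where
  inside : (i : Fin (len π)) → x + toℕ i < len σ
  inside i = ℕP.<-≤-trans (ℕP.+-monoʳ-< x (toℕ<n i)) fits

ρ-count : ∀ π σ → ρ π σ ≡ (+ count (occursAt π σ) (suc (len σ ∸ len π))) ℚ./ suc (len σ ∸ len π)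
ρ-count π σ = cong (λ c → (+ c) ℚ./ suc (len σ ∸ len π)) (length-filter-upTo (occursAt π σ) (suc (len σ ∸ len π)))

ρ-empty : ∀ p σ → ρ (perm 0 p) σ ≡ (+ suc (len σ)) ℚ./ suc (len σ)
ρ-empty p σ = trans (ρ-count (perm 0 p) σ)
  (cong (λ c → (+ c) ℚ./ suc (len σ)) (count-all (occursAt (perm 0 p) σ) (suc (len σ)) (λ _ → refl)))

-- M + 1 blocks of length (d + 1) + g contain (M + 1)(d + 1) + M·g windows of length g + 1.
window-number : ∀ M d g → suc (suc M * (suc d + g) ∸ suc g) ≡ suc M * suc d + M * g
window-number M d g = begin
  suc (suc M * (suc d + g) ∸ suc g)            ≡⟨ cong (λ m → suc (m ∸ suc g)) (split-length M d g) ⟩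
  suc ((M * (suc d + g) + d) + suc g ∸ suc g)  ≡⟨ cong suc (ℕP.m+n∸n≡m (M * (suc d + g) + d) (suc g)) ⟩
  suc (M * (suc d + g) + d)                    ≡⟨ regroup M d g ⟩
  suc M * suc d + M * g ∎
  where
  open ≡-Reasoning
  split-length : ∀ M d g → suc M * (suc d + g) ≡ (M * (suc d + g) + d) + suc g
  split-length = solve-∀
  regroup : ∀ M d g → suc (M * (suc d + g) + d) ≡ suc M * suc d + M * g
  regroup = solve-∀

ρ-repeats : ∀ π σ ψ M → Repeats σ ψ M → 0 < M → len π ≤ len σ →
  ∣ ρ π ψ ℚ.- ρ π σ ∣ ℚ.≤ (+ len π) ℚ./ suc (len σ ∸ len π)
ρ-repeats (perm zero p) σ ψ M _ _ _ =
  subst₂ (λ x y → ∣ x ℚ.- y ∣ ℚ.≤ (+ 0) ℚ./ suc (len σ)) (sym (ρ-empty p ψ)) (sym (ρ-empty p σ))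
    (fraction-distance (suc (len ψ)) (suc (len σ)) 0 (len ψ) (len σ)
      (ℕP.≤-reflexive (same-product (len ψ) (len σ))) (ℕP.≤-reflexive (same-product′ (len ψ) (len σ))))
  where
  same-product : ∀ w d → suc w * suc d ≡ (suc d + 0) * suc w
  same-product = solve-∀
  same-product′ : ∀ w d → suc d * suc w ≡ suc w * suc d + 0 * suc w
  same-product′ = solve-∀
ρ-repeats π@(perm (suc g) _) σ ψ (suc M) reps _ k≤n =
  subst₂ (λ x y → ∣ x ℚ.- y ∣ ℚ.≤ (+ suc g) ℚ./ D) (sym (ρ-count π ψ)) (sym (ρ-count π σ))
    (fraction-distance A O (suc g) w d
      (subst₂ (λ A W → A * D ≤ (O + suc g) * W) (sym count-eq) (sym W-eq) (proj₁ bounds))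
      (subst₂ (λ A W → O * W ≤ A * D + suc g * W) (sym count-eq) (sym W-eq) (proj₂ bounds)))
  where
  d = len σ ∸ suc g
  D = suc d
  w = len ψ ∸ suc g
  A = count (occursAt π ψ) (suc w)
  O = count (occursAt π σ) D
  -- σ has D windows for π, followed by g positions where no window fits.
  n-eq : len σ ≡ D + g
  n-eq = trans (sym (ℕP.m∸n+n≡m k≤n)) (ℕP.+-suc d g)
  agree : ∀ b x → b ≤ M → x < D → occursAt π ψ ((D + g) * b + x) ≡ occursAt π σ x
  agree b x b≤M x<D = subst (λ n → occursAt π ψ (n * b + x) ≡ occursAt π σ x) n-eq
    (window-in-block π σ ψ (suc M) b x reps (s≤s b≤M)
      (subst (x + suc g ≤_) (sym n-eq) (subst (_≤ D + g) (sym (ℕP.+-suc x g)) (ℕP.+-monoˡ-≤ g x<D))))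
  W-eq : suc w ≡ suc M * D + M * g
  W-eq = trans (cong (λ n → suc (n ∸ suc g)) (trans (length-eq reps) (cong (suc M *_) n-eq)))
               (window-number M d g)
  -- Each block contributes O windows, each of the M gaps at most g more.
  blocks : ∃ λ r → r ≤ M * g × count (occursAt π ψ) (suc M * D + M * g) ≡ suc M * O + r
  blocks = repeated-count (occursAt π ψ) (occursAt π σ) D g M agree
  r = proj₁ blocks
  count-eq : A ≡ suc M * O + r
  count-eq = trans (cong (count (occursAt π ψ)) W-eq) (proj₂ (proj₂ blocks))
  bounds : (suc M * O + r) * D ≤ (O + suc g) * (suc M * D + M * g)
         × O * (suc M * D + M * g) ≤ (suc M * O + r) * D + suc g * (suc M * D + M * g)
  bounds = repeated-density-bounds O D g M r (count≤ (occursAt π σ) D) (proj₁ (proj₂ blocks))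

-- The block product σ ⊙ τ of σ ∈ S_n and τ ∈ S_m has length m·n and
--   (σ ⊙ τ)(n·b + a) = m·σ(a) + τ⁻¹(b)      (a < n, b < m):
-- it is the bijection Fin (m·n) ≅ Fin m × Fin n → Fin n × Fin m ≅ Fin (n·m) = Fin (m·n)
-- sending (b , a) to (σ(a) , τ⁻¹(b)).
block-product : ∀ {n m} → Permutation′ n → Permutation′ m → Permutation′ (m * n)
block-product {n} {m} σ τ =
  cast-id (ℕP.*-comm n m) ↔-∘ (↔-sym *↔× ↔-∘ ((σ ×-↔ flip τ) ↔-∘ (×-comm _ _ ↔-∘ *↔×)))

_⊙_ : Perm → Perm → Perm
perm n σ ⊙ perm m τ = perm (m * n) (block-product σ τ)

valℕ-at : ∀ {N} (s : Permutation′ N) (i : Fin N) {j} → toℕ i ≡ j → valℕ (perm N s) j ≡ toℕ (s ⟨$⟩ʳ i)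
valℕ-at {N} s i {j} refl with toℕ i <? N
... | yes i<N = cong (toℕ ∘ (s ⟨$⟩ʳ_)) (fromℕ<-toℕ i i<N)
... | no  i≮N = ⊥-elim (i≮N (toℕ<n i))

toℕ-combine-fromℕ< : ∀ {m n b a} (b<m : b < m) (a<n : a < n) →
  toℕ (combine (fromℕ< b<m) (fromℕ< a<n)) ≡ n * b + a
toℕ-combine-fromℕ< {n = n} b<m a<n =
  trans (toℕ-combine (fromℕ< b<m) (fromℕ< a<n)) (cong₂ (λ u v → n * u + v) (toℕ-fromℕ< b<m) (toℕ-fromℕ< a<n))

<ᵇ-scaled : ∀ m u v t → 0 < m → (m * u + t <ᵇ m * v + t) ≡ (u <ᵇ v)
<ᵇ-scaled m@(suc _) u v t _ = det
  (fromEquivalence (λ lt → ℕP.*-cancelˡ-< m u v (ℕP.+-cancelʳ-< t (m * u) (m * v) (ℕP.<ᵇ⇒< _ _ lt)))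
                   (λ u<v → ℕP.<⇒<ᵇ (ℕP.+-monoˡ-< t (ℕP.*-monoʳ-< m u<v))))
  (ℕP.<ᵇ-reflects-< u v)

module _ {n m : ℕ} (s : Permutation′ n) (t : Permutation′ m) where
  open ≡-Reasoning

  ⊙-combine : ∀ (b : Fin m) (a : Fin n) →
    toℕ (block-product s t ⟨$⟩ʳ combine b a) ≡ m * toℕ (s ⟨$⟩ʳ a) + toℕ (t ⟨$⟩ˡ b)
  ⊙-combine b a = begin
    toℕ (block-product s t ⟨$⟩ʳ combine b a)
      ≡⟨ toℕ-cast (ℕP.*-comm n m) _ ⟩
    toℕ (combine (s ⟨$⟩ʳ proj₂ (remQuot {m} n (combine b a))) (t ⟨$⟩ˡ proj₁ (remQuot {m} n (combine b a))))
      ≡⟨ cong (λ (q : Fin m × Fin n) → toℕ (combine (s ⟨$⟩ʳ proj₂ q) (t ⟨$⟩ˡ proj₁ q))) (remQuot-combine b a) ⟩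
    toℕ (combine (s ⟨$⟩ʳ a) (t ⟨$⟩ˡ b))
      ≡⟨ toℕ-combine (s ⟨$⟩ʳ a) (t ⟨$⟩ˡ b) ⟩
    m * toℕ (s ⟨$⟩ʳ a) + toℕ (t ⟨$⟩ˡ b) ∎

  ⊙-inverse-combine : ∀ (d : Fin n) (c : Fin m) →
    toℕ (block-product s t ⟨$⟩ˡ cast (ℕP.*-comm n m) (combine d c)) ≡ n * toℕ (t ⟨$⟩ʳ c) + toℕ (s ⟨$⟩ˡ d)
  ⊙-inverse-combine d c = begin
    toℕ (block-product s t ⟨$⟩ˡ cast (ℕP.*-comm n m) (combine d c))
      ≡⟨ cong (λ x → toℕ (combine (t ⟨$⟩ʳ proj₂ (remQuot {n} m x)) (s ⟨$⟩ˡ proj₁ (remQuot {n} m x))))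
              (cast-involutive (sym (ℕP.*-comm n m)) (ℕP.*-comm n m) (combine d c)) ⟩
    toℕ (combine (t ⟨$⟩ʳ proj₂ (remQuot {n} m (combine d c))) (s ⟨$⟩ˡ proj₁ (remQuot {n} m (combine d c))))
      ≡⟨ cong (λ (q : Fin n × Fin m) → toℕ (combine (t ⟨$⟩ʳ proj₂ q) (s ⟨$⟩ˡ proj₁ q))) (remQuot-combine d c) ⟩
    toℕ (combine (t ⟨$⟩ʳ c) (s ⟨$⟩ˡ d))
      ≡⟨ toℕ-combine (t ⟨$⟩ʳ c) (s ⟨$⟩ˡ d) ⟩
    n * toℕ (t ⟨$⟩ʳ c) + toℕ (s ⟨$⟩ˡ d) ∎

  ⊙-value : ∀ b a (b<m : b < m) (a<n : a < n) →
    valℕ (perm n s ⊙ perm m t) (n * b + a) ≡ m * valℕ (perm n s) a + toℕ (t ⟨$⟩ˡ fromℕ< b<m)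
  ⊙-value b a b<m a<n = begin
    valℕ (perm n s ⊙ perm m t) (n * b + a)      ≡⟨ valℕ-at (block-product s t) (combine b′ a′) (toℕ-combine-fromℕ< b<m a<n) ⟩
    toℕ (block-product s t ⟨$⟩ʳ combine b′ a′)  ≡⟨ ⊙-combine b′ a′ ⟩
    m * toℕ (s ⟨$⟩ʳ a′) + toℕ (t ⟨$⟩ˡ b′)        ≡⟨ cong (λ v → m * v + toℕ (t ⟨$⟩ˡ b′)) (valℕ-at s a′ (toℕ-fromℕ< a<n)) ⟨
    m * valℕ (perm n s) a + toℕ (t ⟨$⟩ˡ b′) ∎
    where
    b′ = fromℕ< b<m
    a′ = fromℕ< a<n

  ⊙-inverse-value : ∀ d c (d<n : d < n) (c<m : c < m) →
    valℕ (inv (perm n s ⊙ perm m t)) (m * d + c) ≡ n * valℕ (perm m t) c + toℕ (s ⟨$⟩ˡ fromℕ< d<n)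
  ⊙-inverse-value d c d<n c<m = begin
    valℕ (inv (perm n s ⊙ perm m t)) (m * d + c) ≡⟨ valℕ-at (flip (block-product s t)) i
                                                      (trans (toℕ-cast (ℕP.*-comm n m) _) (toℕ-combine-fromℕ< d<n c<m)) ⟩
    toℕ (block-product s t ⟨$⟩ˡ i)                ≡⟨ ⊙-inverse-combine d′ c′ ⟩
    n * toℕ (t ⟨$⟩ʳ c′) + toℕ (s ⟨$⟩ˡ d′)          ≡⟨ cong (λ v → n * v + toℕ (s ⟨$⟩ˡ d′)) (valℕ-at t c′ (toℕ-fromℕ< c<m)) ⟨
    n * valℕ (perm m t) c + toℕ (s ⟨$⟩ˡ d′) ∎
    where
    d′ = fromℕ< d<n
    c′ = fromℕ< c<m
    i = cast (ℕP.*-comm n m) (combine d′ c′)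

⊙-repeats-left : ∀ σ τ → Repeats σ (σ ⊙ τ) (len τ)
⊙-repeats-left (perm n s) (perm m t) = record
  { length-eq  = refl
  ; same-order = λ b y z b<m y<n z<n → begin
      (valℕ (perm n s ⊙ perm m t) (n * b + y) <ᵇ valℕ (perm n s ⊙ perm m t) (n * b + z))
        ≡⟨ cong₂ _<ᵇ_ (⊙-value s t b y b<m y<n) (⊙-value s t b z b<m z<n) ⟩
      (m * valℕ (perm n s) y + toℕ (t ⟨$⟩ˡ fromℕ< b<m) <ᵇ m * valℕ (perm n s) z + toℕ (t ⟨$⟩ˡ fromℕ< b<m))
        ≡⟨ <ᵇ-scaled m _ _ _ (ℕP.≤-<-trans z≤n b<m) ⟩
      (valℕ (perm n s) y <ᵇ valℕ (perm n s) z) ∎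
  }
  where open ≡-Reasoning

⊙-repeats-right : ∀ σ τ → Repeats τ (inv (σ ⊙ τ)) (len σ)
⊙-repeats-right (perm n s) (perm m t) = record
  { length-eq  = ℕP.*-comm m n
  ; same-order = λ d y z d<n y<m z<m → begin
      (valℕ (inv (perm n s ⊙ perm m t)) (m * d + y) <ᵇ valℕ (inv (perm n s ⊙ perm m t)) (m * d + z))
        ≡⟨ cong₂ _<ᵇ_ (⊙-inverse-value s t d y d<n y<m) (⊙-inverse-value s t d z d<n z<m) ⟩
      (n * valℕ (perm m t) y + toℕ (s ⟨$⟩ˡ fromℕ< d<n) <ᵇ n * valℕ (perm m t) z + toℕ (s ⟨$⟩ˡ fromℕ< d<n))
        ≡⟨ <ᵇ-scaled n _ _ _ (ℕP.≤-<-trans z≤n d<n) ⟩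
      (valℕ (perm m t) y <ᵇ valℕ (perm m t) z) ∎
  }
  where open ≡-Reasoning

repeats-converge : ∀ (s ψ : ℕ → Perm) (M : ℕ → ℕ) Λ → ConvergesLocally s Λ →
  (∀ j → Repeats (s j) (ψ j) (M j)) → Eventually (λ j → 0 < M j) → ConvergesLocally ψ Λ
repeats-converge s ψ M Λ (s→∞ , s→Λ) reps M>0 = ψ→∞ , ψ→Λ
  where
  longer : ∀ j → 0 < M j → len (s j) ≤ len (ψ j)
  longer j 0<M = subst (len (s j) ≤_) (sym (length-eq (reps j)))
    (ℕP.m≤n*m (len (s j)) (M j) {{ℕ.>-nonZero 0<M}})
  ψ→∞ : LengthsDiverge ψ
  ψ→∞ L = eventually-map (λ j (L≤s , 0<M) → ℕP.≤-trans L≤s (longer j 0<M))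
            (eventually-both (s→∞ L) M>0)
  ψ→Λ : ∀ π → ConvergesTo (λ j → ρ π (ψ j)) (Λ π)
  ψ→Λ π = converges-if-close (λ j → ρ π (s j)) (λ j → ρ π (ψ j)) (Λ π) (s→Λ π)
    (close-if-window-bounded (λ j → ρ π (ψ j)) (λ j → ρ π (s j)) (len π) (λ j → len (s j)) s→∞
      (eventually-map (λ j (k≤n , 0<M) → ρ-repeats π (s j) (ψ j) (M j) (reps j) 0<M k≤n)
        (eventually-both (s→∞ (len π)) M>0)))

-- φ_j = s_j ⊙ t_j; the block counts |t_j| and |s_j| are eventually positive since the lengths diverge.
proposition4p3 : (Λ Λ′ : Perm → ℝ) → IsLocalLimit Λ → IsLocalLimit Λ′ →
    ∃ λ (φ : ℕ → Perm) → ConvergesLocally φ Λ × ConvergesLocally (λ j → inv (φ j)) Λ′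
proposition4p3 Λ Λ′ (s , s→Λ) (t , t→Λ′) =
  φ , repeats-converge s φ (len ∘ t) Λ s→Λ (λ j → ⊙-repeats-left (s j) (t j)) (proj₁ t→Λ′ 1)
    , repeats-converge t (inv ∘ φ) (len ∘ s) Λ′ t→Λ′ (λ j → ⊙-repeats-right (s j) (t j)) (proj₁ s→Λ 1)
  where
  φ : ℕ → Perm
  φ j = s j ⊙ t j
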